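{- Let $(\mathcal{C},\mathcal{K})$ be a connective island domain on $U$ and let $\mathcal{H}\subseteq\mathcal{C}\setminus\{\emptyset\}$ with $U\in\mathcal{H}$. If $\mathcal{H}$ is a distant family, then $\mathcal{H}$ is a system of islands corresponding to $(\mathcal{C},\mathcal{K})$; moreover, $\mathcal{H}$ is the system of islands corresponding to $(\mathcal{C},\mathcal{K},h)$ where $h$ is the standard height function of $\mathcal{H}$.
   Context: An island domain is a pair $(\mathcal{C},\mathcal{K})$ where $U$ is a nonempty finite set and $\mathcal{C}\subseteq\mathcal{K}\subseteq\mathcal{P}(U)$ with $U\in\mathcal{C}$. It is connective if for all $A,B\in\mathcal{C}$ with $A\cap B\neq\emptyset$ and $B\not\subseteq A$ there exists $K\in\mathcal{K}$ with $A\subsetneq K\subseteq A\cup B$. A height function is any map $h\colon U\to\mathbb{R}$. Let $\prec$ denote the cover relation of $(\mathcal{K},\subseteq)$ and write $A\preceq K$ if $A\prec K$ or $A=K$. A nonempty $S\in\mathcal{C}$ is an island with respect to $(\mathcal{C},\mathcal{K},h)$ if for every $K\in\mathcal{K}$ with $S\prec K$ and every $u\in K\setminus S$ we have $h(u)<\min h(S)$. The system of islands corresponding to $(\mathcal{C},\mathcal{K},h)$ is the set of all nonempty $S\in\mathcal{C}$ that are islands with respect to $(\mathcal{C},\mathcal{K},h)$; a system of islands corresponding to $(\mathcal{C},\mathcal{K})$ is a family equal to this set for some height function $h$. Define $\delta$ on $\mathcal{C}$ by $A\,\delta\,B$ iff there is $K\in\mathcal{K}$ with $A\preceq K$ and $K\cap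 B\neq\emptyset$. $A,B\in\mathcal{C}$ are distant if neither $A\,\delta\,B$ nor $B\,\delta\,A$; a nonempty family $\mathcal{H}\subseteq\mathcal{C}$ is distant if any two incomparable members of it are distant. For a family $\mathcal{H}$ whose members are pairwise comparable or disjoint, its standard height function assigns to each $u\in U$ the number of members of $\mathcal{H}$ containing $u$, minus one. -}

module Defs where

open import Data.Nat using (ℕ; zero; suc)
open import Data.Bool using (Bool; true; false; T; _∧_)
open import Data.Vec using (Vec; []; _∷_; lookup)
open import Data.List using (List; []; _∷_; map; _++_; length; filterᵇ)
open import Data.Fin using (Fin)
open import Data.Fin.Subset using (Subset; _∈_; _∉_; _⊆_; _⊂_; _∪_; _∩_; Nonempty; ⊤)
open import Data.Product using (Σ; _×_; ∃)
open import Data.Integer using (+_)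
open import Data.Rational using (ℚ; _<_; _/_; _-_; 1ℚ)
open import Relation.Nullary using (¬_)
open import Relation.Binary.PropositionalEquality using (_≡_)
open import Function.Bundles using (_⇔_)

-- The universe U is Fin n (nonempty requires n ≥ 1, imposed in the theorem).
-- A family of subsets of U is a Boolean-valued predicate on Subset n
-- (U is finite, so every family is a finite, decidable set of subsets).
Family : ℕ → Set
Family n = Subset n → Bool

_∈F_ : ∀ {n} → Subset n → Family n → Set
A ∈F F = T (F A)

IsIslandDomain : ∀ {n} → Family n → Family n → Set
IsIslandDomain {n} C K = (∀ A → A ∈F C → A ∈F K) × (⊤ ∈F C)

IsConnective : ∀ {n} → Family n → Family n → Set
IsConnective {n} C K =
  ∀ (A B : Subset n) → A ∈F C → B ∈F C → Nonempty (A ∩ B) → ¬ (B ⊆ A) →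
  Σ (Subset n) λ K′ → K′ ∈F K × A ⊂ K′ × K′ ⊆ A ∪ B

Covers : ∀ {n} → Family n → Subset n → Subset n → Set
Covers {n} K A B =
  A ∈F K × B ∈F K × A ⊂ B ×
  (∀ (X : Subset n) → X ∈F K → A ⊂ X → ¬ (X ⊂ B))

CoversOrEq : ∀ {n} → Family n → Subset n → Subset n → Set
CoversOrEq K A B = Covers K A B Data.Sum.⊎ (A ≡ B)
  where import Data.Sum

Height : ℕ → Set
Height n = Fin n → ℚ

-- S is an island w.r.t. (C, K, h).
-- "h(u) < min h(S)" is written as: h(u) < h(v) for every v ∈ S (S nonempty).
IsIsland : ∀ {n} → Family n → Family n → Height n → Subset n → Set
IsIsland {n} C K h S =
  S ∈F C × Nonempty S ×
  (∀ (K′ : Subset n) → K′ ∈F K → Covers K S K′ →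
     ∀ (u : Fin n) → u ∈ K′ → u ∉ S → ∀ (v : Fin n) → v ∈ S → h u < h v)

IsSystemOfIslandsFor : ∀ {n} → Family n → Family n → Height n → Family n → Set
IsSystemOfIslandsFor {n} C K h H = ∀ (S : Subset n) → (S ∈F H ⇔ IsIsland C K h S)

IsSystemOfIslands : ∀ {n} → Family n → Family n → Family n → Set
IsSystemOfIslands {n} C K H = ∃ λ (h : Height n) → IsSystemOfIslandsFor C K h H

Delta : ∀ {n} → Family n → Subset n → Subset n → Set
Delta {n} K A B = Σ (Subset n) λ K′ → K′ ∈F K × CoversOrEq K A K′ × Nonempty (K′ ∩ B)

Distant : ∀ {n} → Family n → Subset n → Subset n → Set
Distant K A B = ¬ Delta K A B × ¬ Delta K B A

IsDistantFamily : ∀ {n} → Family n → Family n → Family n → Set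
IsDistantFamily {n} C K H =
  (∀ A → A ∈F H → A ∈F C) × (Σ (Subset n) λ A → A ∈F H) ×
  (∀ (A B : Subset n) → A ∈F H → B ∈F H → ¬ (A ⊆ B) → ¬ (B ⊆ A) → Distant K A B)

allSubsets : (n : ℕ) → List (Subset n)
allSubsets zero = [] ∷ []
allSubsets (suc n) = map (true ∷_) (allSubsets n) ++ map (false ∷_) (allSubsets n)

countContaining : ∀ {n} → Family n → Fin n → ℕ
countContaining {n} H u = length (filterᵇ (λ A → H A ∧ lookup A u) (allSubsets n))

standardHeight : ∀ {n} → Family n → Height n
standardHeight H u = ((+ countContaining H u) / 1) - 1ℚ

-- Let H be a distant family in a connective island domain (C, K) with U ∈ H,
-- and let c(u) be the number of members of H containing u, so that the
-- standard height is h(u) = c(u) - 1.  The argument has three ingredients.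
--
--  * Laminarity.  Two members of H sharing a point are comparable, and if
--    K′ covers S ∈ H then every member of H meeting K′ ∖ S contains S
--    (otherwise S δ A).  Hence c strictly drops when leaving S through a cover.
--  * Members are islands: this drop is exactly the island condition.
--  * Islands are members: for an island S pick v ∈ S with c(v) minimal and a
--    smallest member B ∈ H containing v.  Connectivity applied to (B, S)
--    forces S ⊆ B; if S ≠ B, connectivity applied to (S, B) yields a cover of
--    S with a new point u ∈ B, and the island condition gives c(u) < c(v),
--    while minimality of B gives c(v) ≤ c(u).
module Submission where

open import Defs
open import Data.Nat using (ℕ; suc)
open import Data.Fin.Subset using (Nonempty)
open import Data.Fin.Subset using (⊤)
open import Data.Product using (_×_)

open import Data.Nat using (_≤_; _<_)
import Data.Nat.Properties as ℕ
open import Data.Integer as ℤ using (+_)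
import Data.Integer.Properties as ℤ
open import Data.Rational as ℚ using (ℚ; _/_; _-_; 1ℚ; -_; *<*)
import Data.Rational.Properties as ℚ
open import Data.Nat.Coprimality using (1-coprimeTo) renaming (sym to coprime-sym)
open import Data.Bool using (true; false; T; _∧_; T?)
open import Data.Bool.Properties using (T-∧; T-≡)
open import Data.Product using (Σ; _,_; proj₁; proj₂)
open import Data.Sum using (_⊎_; inj₁; inj₂)
open import Data.Empty using (⊥-elim)
open import Data.List using (List; []; _∷_; map; length; filter; allFin)
open import Data.List.Properties using (length-filter; filter-notAll; filter-reject)
open import Data.List.Membership.Propositional using () renaming (_∈_ to _∈ₗ_)
open import Data.List.Membership.Propositional.Properties
  using (∈-map⁺; ∈-++⁺ˡ; ∈-++⁺ʳ; ∈-allFin; ∈-filter⁺)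
open import Data.List.Relation.Unary.Any using (here)
import Data.List.Relation.Unary.Any as Any
import Data.List.Relation.Unary.All as All
open import Data.List.Relation.Unary.All.Properties using (all-filter)
open import Data.List.Extrema.Nat using (argmin; argmin-all; f[argmin]≤f[xs])
open import Data.Vec using (lookup) renaming ([] to []ᵥ; _∷_ to _∷ᵥ_)
open import Data.Vec.Properties using ([]=⇒lookup; lookup⇒[]=)
open import Data.Fin using (Fin)
open import Data.Fin.Subset using (Subset; _∈_; _∉_; _⊆_; _⊂_; ∣_∣)
open import Data.Fin.Subset.Properties
  using (_⊆?_; _⊂?_; _∈?_; x∈p∩q⁺; x∈p∪q⁻; ⊆-antisym; ⊆-trans; p⊂q⇒∣p∣<∣q∣; ∈⊤)
open import Function.Bundles using (_⇔_; mk⇔; Equivalence)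
open import Relation.Binary.PropositionalEquality using (_≡_; refl; sym; trans; cong; subst; subst₂)
open import Relation.Nullary using (¬_; yes; no)
open import Relation.Nullary.Decidable using (_×-dec_; decidable-stable)
open import Relation.Unary using (Pred; Decidable)
open import Level using (0ℓ)

allSubsets-complete : ∀ {n} (p : Subset n) → p ∈ₗ allSubsets n
allSubsets-complete []ᵥ = here refl
allSubsets-complete (true ∷ᵥ p) = ∈-++⁺ˡ (∈-map⁺ (true ∷ᵥ_) (allSubsets-complete p))
allSubsets-complete {suc n} (false ∷ᵥ p) =
  ∈-++⁺ʳ (map (true ∷ᵥ_) (allSubsets n)) (∈-map⁺ (false ∷ᵥ_) (allSubsets-complete p))

minimiser : ∀ {A : Set} {P : Pred A 0ℓ} → Decidable P → (f : A → ℕ) →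
            (xs : List A) → (∀ z → z ∈ₗ xs) →
            ∀ {x} → P x → Σ A λ y → P y × (∀ z → P z → f y ≤ f z)
minimiser P? f xs complete {x} px =
  argmin f x candidates ,
  argmin-all f px (all-filter P? xs) ,
  λ z pz → All.lookup (f[argmin]≤f[xs] x candidates) (∈-filter⁺ P? (complete z) pz)
  where candidates = filter P? xs

filter-absorb : ∀ {A : Set} {P Q : Pred A 0ℓ} (P? : Decidable P) (Q? : Decidable Q) →
                (∀ {x} → P x → Q x) → ∀ xs → filter P? (filter Q? xs) ≡ filter P? xs
filter-absorb P? Q? P⇒Q [] = refl
filter-absorb P? Q? P⇒Q (x ∷ xs) with Q? x
... | no ¬qx = trans (filter-absorb P? Q? P⇒Q xs) (sym (filter-reject P? (λ px → ¬qx (P⇒Q px))))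
... | yes _ with P? x
...   | yes _ = cong (x ∷_) (filter-absorb P? Q? P⇒Q xs)
...   | no _ = filter-absorb P? Q? P⇒Q xs

⊆-size-≥⇒⊇ : ∀ {n} {A B : Subset n} → A ⊆ B → ∣ B ∣ ≤ ∣ A ∣ → B ⊆ A
⊆-size-≥⇒⊇ {A = A} A⊆B ∣B∣≤∣A∣ {x} x∈B with x ∈? A
... | yes x∈A = x∈A
... | no x∉A = ⊥-elim (ℕ.<⇒≱ (p⊂q⇒∣p∣<∣q∣ (A⊆B , x , x∈B , x∉A)) ∣B∣≤∣A∣)

-- The standard height of u is, by definition, shift (countContaining H u);
-- shift is an order embedding of ℕ into ℚ.
shift : ℕ → ℚ
shift c = (+ c / 1) - 1ℚ

shift-mono-< : ∀ {a b} → a < b → shift a ℚ.< shift b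
shift-mono-< {a} {b} a<b = ℚ.+-monoˡ-< (- 1ℚ) a/1<b/1
  where
  a/1<b/1 : (+ a / 1) ℚ.< (+ b / 1)
  a/1<b/1 rewrite ℚ.normalize-coprime {a} {0} (coprime-sym (1-coprimeTo a))
                | ℚ.normalize-coprime {b} {0} (coprime-sym (1-coprimeTo b))
    = *<* (subst₂ ℤ._<_ (sym (ℤ.*-identityʳ (+ a))) (sym (ℤ.*-identityʳ (+ b))) (ℤ.+<+ a<b))

shift-reflects-< : ∀ {a b} → shift a ℚ.< shift b → a < b
shift-reflects-< {a} {b} sa<sb with a ℕ.<? b
... | yes a<b = a<b
... | no a≮b with ℕ.m≤n⇒m<n∨m≡n (ℕ.≮⇒≥ a≮b)
...   | inj₁ b<a = ⊥-elim (ℚ.<-asym sa<sb (shift-mono-< b<a))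
...   | inj₂ refl = ⊥-elim (ℚ.<-irrefl refl sa<sb)

-- Below any strict upper bound of S in K there is a cover of S: take a
-- member of K strictly between S and K₂ of least size.
cover-below : ∀ {n} (K : Family n) {S K₂ : Subset n} → S ∈F K → K₂ ∈F K → S ⊂ K₂ →
              Σ (Subset n) λ K′ → Covers K S K′ × K′ ⊆ K₂
cover-below {n} K {S} {K₂} S∈K K₂∈K S⊂K₂ =
  from-smallest (minimiser between? ∣_∣ (allSubsets n) allSubsets-complete (K₂∈K , S⊂K₂ , λ x → x))
  where
  Between : Subset n → Set
  Between X = X ∈F K × S ⊂ X × X ⊆ K₂

  between? : Decidable Between
  between? X = T? (K X) ×-dec ((S ⊂? X) ×-dec (X ⊆? K₂))

  from-smallest : (Σ (Subset n) λ K′ → Between K′ × (∀ X → Between X → ∣ K′ ∣ ≤ ∣ X ∣)) →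
                  Σ (Subset n) λ K′ → Covers K S K′ × K′ ⊆ K₂
  from-smallest (K′ , (K′∈K , S⊂K′ , K′⊆K₂) , K′-smallest) =
    K′ , (S∈K , K′∈K , S⊂K′ , nothing-between) , K′⊆K₂
    where
    nothing-between : ∀ X → X ∈F K → S ⊂ X → ¬ (X ⊂ K′)
    nothing-between X X∈K S⊂X X⊂K′ =
      ℕ.<⇒≱ (p⊂q⇒∣p∣<∣q∣ X⊂K′) (K′-smallest X (X∈K , S⊂X , ⊆-trans (proj₁ X⊂K′) K′⊆K₂))

connective-cover : ∀ {n} {C K : Family n} → IsIslandDomain C K → IsConnective C K →
  ∀ {A B x} → A ∈F C → B ∈F C → x ∈ A → x ∈ B → ¬ (B ⊆ A) →
  Σ (Subset n) λ K′ → Covers K A K′ × Σ (Fin n) λ u → u ∈ K′ × u ∉ A × u ∈ B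
connective-cover {K = K} (C⊆K , _) conn {A} {B} {x} A∈C B∈C x∈A x∈B B⊈A
  with conn A B A∈C B∈C (x , x∈p∩q⁺ (x∈A , x∈B)) B⊈A
... | K₂ , K₂∈K , A⊂K₂ , K₂⊆A∪B with cover-below K (C⊆K A A∈C) K₂∈K A⊂K₂
...   | K′ , cover@(_ , _ , (_ , u , u∈K′ , u∉A) , _) , K′⊆K₂ =
  K′ , cover , u , u∈K′ , u∉A , new-point-in-B
  where
  new-point-in-B : u ∈ B
  new-point-in-B with x∈p∪q⁻ A B (K₂⊆A∪B (K′⊆K₂ u∈K′))
  ... | inj₁ u∈A = ⊥-elim (u∉A u∈A)
  ... | inj₂ u∈B = u∈B

module Counting {n : ℕ} (H : Family n) where

  c : Fin n → ℕ
  c = countContaining H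

  counted⇔ : ∀ {A u} → T (H A ∧ lookup A u) ⇔ (A ∈F H × u ∈ A)
  counted⇔ {A} {u} = mk⇔
    (λ t → let (A∈H , u∈ᵇA) = Equivalence.to T-∧ t
           in A∈H , lookup⇒[]= u A (Equivalence.to T-≡ u∈ᵇA))
    (λ (A∈H , u∈A) → Equivalence.from T-∧ (A∈H , Equivalence.from T-≡ ([]=⇒lookup u∈A)))

  _⊑_ : Fin n → Fin n → Set
  u ⊑ v = ∀ A → A ∈F H → u ∈ A → v ∈ A

  private
    Holds : Fin n → Pred (Subset n) 0ℓ
    Holds u A = T (H A ∧ lookup A u)

    holds? : ∀ u → Decidable (Holds u)
    holds? u A = T? (H A ∧ lookup A u)

    absorb : ∀ {u v} → u ⊑ v → filter (holds? u) (filter (holds? v) (allSubsets n)) ≡ filter (holds? u) (allSubsets n)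
    absorb {u} {v} u⊑v = filter-absorb (holds? u) (holds? v)
      (λ t → let (A∈H , u∈A) = Equivalence.to counted⇔ t
             in Equivalence.from counted⇔ (A∈H , u⊑v _ A∈H u∈A))
      (allSubsets n)

  count-mono : ∀ {u v} → u ⊑ v → c u ≤ c v
  count-mono {u} {v} u⊑v =
    subst (_≤ c v) (cong length (absorb u⊑v)) (length-filter (holds? u) (filter (holds? v) (allSubsets n)))

  -- Strictness: a member containing v but not u is counted only for v.
  count-strict-mono : ∀ {u v B} → u ⊑ v → B ∈F H → v ∈ B → u ∉ B → c u < c v
  count-strict-mono {u} {v} {B} u⊑v B∈H v∈B u∉B =
    subst (_< c v) (cong length (absorb u⊑v))
      (filter-notAll (holds? u) (filter (holds? v) (allSubsets n)) B-not-counted-for-u)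
    where
    B∈vs : B ∈ₗ filter (holds? v) (allSubsets n)
    B∈vs = ∈-filter⁺ (holds? v) (allSubsets-complete B) (Equivalence.from counted⇔ (B∈H , v∈B))
    B-not-counted-for-u = Any.map (λ { refl t → u∉B (proj₂ (Equivalence.to counted⇔ t)) }) B∈vs

PairwiseDistant : ∀ {n} → Family n → Family n → Set
PairwiseDistant {n} K H = ∀ (A B : Subset n) → A ∈F H → B ∈F H → ¬ (A ⊆ B) → ¬ (B ⊆ A) → Distant K A B

module DistantFamily {n : ℕ} {K H : Family n} (distant : PairwiseDistant K H) where

  open Counting H

  -- Members of H that share a point are comparable (A δ B through K′ = A).
  meeting-comparable : (∀ A → A ∈F H → A ∈F K) → ∀ {A B x} → A ∈F H → B ∈F H →
                       x ∈ A → x ∈ B → A ⊆ B ⊎ B ⊆ A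
  meeting-comparable H⊆K {A} {B} {x} A∈H B∈H x∈A x∈B with A ⊆? B | B ⊆? A
  ... | yes A⊆B | _ = inj₁ A⊆B
  ... | no _ | yes B⊆A = inj₂ B⊆A
  ... | no A⊈B | no B⊈A =
    ⊥-elim (proj₁ (distant A B A∈H B∈H A⊈B B⊈A) (A , H⊆K A A∈H , inj₂ refl , x , x∈p∩q⁺ (x∈A , x∈B)))

  cover-exit-above : ∀ {S K′ u} → S ∈F H → Covers K S K′ → u ∈ K′ → u ∉ S →
                     ∀ A → A ∈F H → u ∈ A → S ⊆ A
  cover-exit-above {S} {K′} {u} S∈H cover u∈K′ u∉S A A∈H u∈A with S ⊆? A
  ... | yes S⊆A = S⊆A
  ... | no S⊈A with A ⊆? S
  ...   | yes A⊆S = ⊥-elim (u∉S (A⊆S u∈A))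
  ...   | no A⊈S = ⊥-elim (proj₁ (distant S A S∈H A∈H S⊈A A⊈S)
                     (K′ , proj₁ (proj₂ cover) , inj₁ cover , u , x∈p∩q⁺ (u∈K′ , u∈A)))

  cover-exit-lower : ∀ {S K′ u v} → S ∈F H → Covers K S K′ → u ∈ K′ → u ∉ S → v ∈ S → c u < c v
  cover-exit-lower S∈H cover u∈K′ u∉S v∈S =
    count-strict-mono (λ A A∈H u∈A → cover-exit-above S∈H cover u∈K′ u∉S A A∈H u∈A v∈S) S∈H v∈S u∉S

module Islands {n : ℕ} {C K H : Family n}
  (domain : IsIslandDomain C K) (connective : IsConnective C K)
  (H⊆C : ∀ A → A ∈F H → A ∈F C × Nonempty A) (U∈H : ⊤ ∈F H)
  (distant : PairwiseDistant K H) where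

  open Counting H
  open DistantFamily distant

  H⊆K : ∀ A → A ∈F H → A ∈F K
  H⊆K A A∈H = proj₁ domain A (proj₁ (H⊆C A A∈H))

  members-are-islands : ∀ S → S ∈F H → IsIsland C K (standardHeight H) S
  members-are-islands S S∈H =
    proj₁ (H⊆C S S∈H) , proj₂ (H⊆C S S∈H) ,
    λ K′ _ cover u u∈K′ u∉S v v∈S → shift-mono-< (cover-exit-lower S∈H cover u∈K′ u∉S v∈S)

  -- If v is a point of S ∈ C with minimal c, every member B of H through v
  -- contains S: otherwise a cover of B would reach a point of S with smaller c.
  lowest-point-forces-inclusion : ∀ {S v B} → S ∈F C → v ∈ S → (∀ z → z ∈ S → c v ≤ c z) →
                                  B ∈F H → v ∈ B → S ⊆ B
  lowest-point-forces-inclusion {S} {v} {B} S∈C v∈S v-lowest B∈H v∈B =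
    decidable-stable (S ⊆? B) S⊈B-impossible
    where
    S⊈B-impossible : ¬ ¬ (S ⊆ B)
    S⊈B-impossible S⊈B =
      let (_ , cover , w , w∈K′ , w∉B , w∈S) =
            connective-cover domain connective (proj₁ (H⊆C B B∈H)) S∈C v∈B v∈S S⊈B
      in ℕ.<⇒≱ (cover-exit-lower B∈H cover w∈K′ w∉B v∈B) (v-lowest w w∈S)

  smallest-member-least : ∀ {v B} → B ∈F H → v ∈ B →
                          (∀ A → A ∈F H × v ∈ A → ∣ B ∣ ≤ ∣ A ∣) →
                          ∀ A → A ∈F H → v ∈ A → B ⊆ A
  smallest-member-least B∈H v∈B B-smallest A A∈H v∈A
    with meeting-comparable H⊆K A∈H B∈H v∈A v∈B
  ... | inj₁ A⊆B = ⊆-size-≥⇒⊇ A⊆B (B-smallest A (A∈H , v∈A))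
  ... | inj₂ B⊆A = B⊆A

  -- Conversely, if v lies in an island S, a smallest member B of H through v
  -- lies inside S: otherwise a cover of S reaches a point u ∈ B, which the
  -- island condition puts strictly below v, although B ⊆ A for every
  -- member A through v gives c(v) ≤ c(u).
  smallest-member-inside-island : ∀ {S v B} → IsIsland C K (standardHeight H) S → v ∈ S →
                                  B ∈F H → v ∈ B → (∀ A → A ∈F H × v ∈ A → ∣ B ∣ ≤ ∣ A ∣) → B ⊆ S
  smallest-member-inside-island {S} {v} {B} (S∈C , _ , island) v∈S B∈H v∈B B-smallest =
    decidable-stable (B ⊆? S) B⊈S-impossible
    where
    B⊈S-impossible : ¬ ¬ (B ⊆ S)
    B⊈S-impossible B⊈S =
      let (K′ , cover , u , u∈K′ , u∉S , u∈B) =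
            connective-cover domain connective S∈C (proj₁ (H⊆C B B∈H)) v∈S v∈B B⊈S
          u-below-v = shift-reflects-< (island K′ (proj₁ (proj₂ cover)) cover u u∈K′ u∉S v v∈S)
          v-below-u = count-mono (λ A A∈H v∈A → smallest-member-least B∈H v∈B B-smallest A A∈H v∈A u∈B)
      in ℕ.<⇒≱ u-below-v v-below-u

  -- An island S equals the smallest member of H through its lowest point.
  islands-are-members : ∀ S → IsIsland C K (standardHeight H) S → S ∈F H
  islands-are-members S S-island@(S∈C , (x , x∈S) , _) =
    let (v , v∈S , v-lowest) = minimiser (_∈? S) c (allFin n) ∈-allFin x∈S
        (B , (B∈H , v∈B) , B-smallest) =
          minimiser (λ B → T? (H B) ×-dec (v ∈? B)) ∣_∣ (allSubsets n) allSubsets-complete (U∈H , ∈⊤)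
        B⊆S = smallest-member-inside-island S-island v∈S B∈H v∈B B-smallest
        S⊆B = lowest-point-forces-inclusion S∈C v∈S v-lowest B∈H v∈B
    in subst (_∈F H) (⊆-antisym B⊆S S⊆B) B∈H

  standard-height-system : IsSystemOfIslandsFor C K (standardHeight H) H
  standard-height-system S = mk⇔ (members-are-islands S) (islands-are-members S)

theorem5p6 : ∀ (m : ℕ) (C K H : Family (suc m)) →
    IsIslandDomain C K → IsConnective C K →
    (∀ A → A ∈F H → A ∈F C × Nonempty A) → ⊤ ∈F H →
    IsDistantFamily C K H →
    IsSystemOfIslands C K H × IsSystemOfIslandsFor C K (standardHeight H) H
theorem5p6 m C K H domain connective H⊆C U∈H (_ , _ , distant) =
  (standardHeight H , system) , system
  where system = Islands.standard-height-system domain connective H⊆C U∈H distant
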